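{- Let $d(t)=\sum_{n\ge 0}d_nt^n$ and $h(t)=\sum_{n\ge 0}h_nt^n$ be formal power series with real coefficients, and let $R=\mathcal{R}(d(t),h(t))$ be the Riordan array they determine. If the Hessenberg matrix \[ H=\left[\begin{array}{ccccc} d_0 & h_0 & 0 & 0 &\cdots\\ d_1 & h_1 & h_0 & 0 &\\ d_2 & h_2 & h_1 & h_0 &\\ \vdots&\vdots&&&\ddots \end{array}\right] \] (i.e., the infinite matrix whose column $0$ is $(d_0,d_1,d_2,\ldots)^T$ and whose column $j\ge 1$ is $(0,\ldots,0,h_0,h_1,h_2,\ldots)^T$ with $j-1$ leading zeros) is totally positive, then $R$ is totally positive.
   Context: An infinite matrix is called totally positive if all of its minors (of all orders) are nonnegative. For formal power series $d(t)$ and $h(t)$, the Riordan array $\mathcal{R}(d(t),h(t))=[r_{n,k}]_{n,k\ge 0}$ is the infinite matrix whose $k$th column has generating function $d(t)h(t)^k$ for each $k\ge 0$, i.e., $r_{n,k}=[t^n]\,d(t)h(t)^k$. No properness assumption ($h_0=0$, $d_0\ne 0$, $h_1\neq 0$) is imposed. -}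

module Defs where

open import Level using (Level; _⊔_)
open import Data.Nat as ℕ using (ℕ; zero; suc)
open import Data.Fin as Fin using (Fin; zero; suc; punchIn)
open import Algebra.Bundles using (CommutativeRing)
open import Relation.Binary.Structures using (IsTotalOrder)
import Relation.Nullary

-- An ordered commutative ring (the real numbers ℝ being the intended instance):
-- a commutative ring with a total order compatible with + and with
-- products of nonnegative elements nonnegative.
record OrderedCommutativeRing (c ℓ₁ ℓ₂ : Level) : Set (Level.suc (c ⊔ ℓ₁ ⊔ ℓ₂)) where
  field
    commutativeRing : CommutativeRing c ℓ₁
  open CommutativeRing commutativeRing public
  field
    _≤_          : Carrier → Carrier → Set ℓ₂
    isTotalOrder : IsTotalOrder _≈_ _≤_
    +-mono-≤     : ∀ {a b} c → a ≤ b → (a + c) ≤ (b + c)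
    *-nonneg     : ∀ {a b} → 0# ≤ a → 0# ≤ b → 0# ≤ (a * b)

module _ {c ℓ₁ ℓ₂} (R : OrderedCommutativeRing c ℓ₁ ℓ₂) where
  open OrderedCommutativeRing R using (Carrier; _+_; _*_; -_; 0#; 1#; _≤_)

  Series : Set c
  Series = ℕ → Carrier

  Matrix : Set c
  Matrix = ℕ → ℕ → Carrier

  sumTo : ℕ → (ℕ → Carrier) → Carrier
  sumTo zero    f = 0#
  sumTo (suc n) f = sumTo n f + f n

  sumFin : (n : ℕ) → (Fin n → Carrier) → Carrier
  sumFin zero    f = 0#
  sumFin (suc n) f = f zero + sumFin n (λ j → f (suc j))

  _·_ : Series → Series → Series
  (f · g) n = sumTo (suc n) (λ i → f i * g (n ℕ.∸ i))

  one : Series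
  one zero    = 1#
  one (suc _) = 0#

  pow : Series → ℕ → Series
  pow h zero    = one
  pow h (suc k) = pow h k · h

  riordan : Series → Series → Matrix
  riordan d h n k = (d · pow h k) n

  hessenberg : Series → Series → Matrix
  hessenberg d h n zero = d n
  hessenberg d h n (suc j) with j ℕ.≤? n
  ... | Relation.Nullary.yes _ = h (suc n ℕ.∸ suc j)
  ... | Relation.Nullary.no  _ = 0#

  signed : ℕ → Carrier → Carrier
  signed zero    x = x
  signed (suc j) x = - signed j x

  det : (m : ℕ) → (Fin m → Fin m → Carrier) → Carrier
  det zero    A = 1#
  det (suc m) A =
    sumFin (suc m) (λ j → signed (Fin.toℕ j)
      (A zero j * det m (λ r s → A (suc r) (punchIn j s))))

  StrictlyIncreasing : {m : ℕ} → (Fin m → ℕ) → Set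
  StrictlyIncreasing {m} σ = ∀ (a b : Fin m) → a Fin.< b → σ a ℕ.< σ b

  TotallyPositive : Matrix → Set ℓ₂
  TotallyPositive M =
    ∀ (m : ℕ) (rows cols : Fin m → ℕ) →
      StrictlyIncreasing rows → StrictlyIncreasing cols →
      0# ≤ det m (λ a b → M (rows a) (cols b))

-- Since the (k+1)-st column of R is the convolution of its k-th column with h, we have
-- R = H · (1 ⊕ R), where 1 ⊕ R is R shifted down and right with a new corner entry 1;
-- the sums in this product are finite because H is lower Hessenberg. By the Cauchy–Binet
-- formula every minor of R is a sum of products of a minor of H and a minor of 1 ⊕ R, and
-- a minor of 1 ⊕ R whose columns lie below K + 1 is 0 or a minor of R whose columns lie
-- below K. Induction on K gives total positivity.
module Submission where

open import Level using (Level; _⊔_)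
open import Data.Empty using (⊥-elim)
open import Data.Fin as Fin using (Fin; zero; suc; punchIn; toℕ)
open import Data.Nat as ℕ using (ℕ; zero; suc; z≤n; s≤s; _∸_)
import Data.Nat.Properties as ℕₚ
open import Data.Product using (_×_; _,_)
open import Data.Sum as Sum using (_⊎_; inj₁; inj₂)
open import Data.Unit using (⊤; tt)
open import Data.Vec.Functional using ([]; _∷_)
open import Function using (_∘_)
open import Relation.Binary.PropositionalEquality as ≡ using (_≡_; _≗_)
open import Relation.Binary.Structures using (IsTotalOrder)
open import Relation.Nullary using (Dec; yes; no; ¬_)

open import Defs

-- A total punchOut: punchOut′ j j is a junk value.
punchOut′ : ∀ {n} → Fin (suc (suc n)) → Fin (suc (suc n)) → Fin (suc n)
punchOut′ zero    zero    = zero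
punchOut′ zero    (suc k) = k
punchOut′ {zero}  (suc j) k       = zero
punchOut′ {suc n} (suc j) zero    = zero
punchOut′ {suc n} (suc j) (suc k) = suc (punchOut′ j k)

punchOut′-punchIn : ∀ {n} (j : Fin (suc (suc n))) (l : Fin (suc n)) → punchOut′ j (punchIn j l) ≡ l
punchOut′-punchIn zero    l       = ≡.refl
punchOut′-punchIn {zero}  (suc j) zero    = ≡.refl
punchOut′-punchIn {suc n} (suc j) zero    = ≡.refl
punchOut′-punchIn {suc n} (suc j) (suc l) = ≡.cong suc (punchOut′-punchIn j l)

Adjacent : ℕ → ℕ → Set
Adjacent x y = y ≡ suc x ⊎ x ≡ suc y

Adjacent-suc-+-suc : ∀ {a b c d} → Adjacent (a ℕ.+ b) (c ℕ.+ d) →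
                     Adjacent (suc a ℕ.+ suc b) (suc c ℕ.+ suc d)
Adjacent-suc-+-suc {a} {b} {c} {d} adj
  rewrite ℕₚ.+-suc a b | ℕₚ.+-suc c d = Sum.map (≡.cong (2 ℕ.+_)) (≡.cong (2 ℕ.+_)) adj

-- Exchanging the roles of the columns j and k = punchIn j l in a Laplace expansion along
-- the first two rows changes the exponent of the sign by one.
punchIn-transpose-adjacent : ∀ {n} (j : Fin (suc (suc n))) (l : Fin (suc n)) →
  Adjacent (toℕ j ℕ.+ toℕ l) (toℕ (punchIn j l) ℕ.+ toℕ (punchOut′ (punchIn j l) j))
punchIn-transpose-adjacent {zero}  zero    l       = inj₁ (≡.cong suc (ℕₚ.+-identityʳ _))
punchIn-transpose-adjacent {suc n} zero    l       = inj₁ (≡.cong suc (ℕₚ.+-identityʳ _))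
punchIn-transpose-adjacent         (suc j) zero    = inj₂ (≡.cong suc (ℕₚ.+-identityʳ _))
punchIn-transpose-adjacent {suc n} (suc j) (suc l) = Adjacent-suc-+-suc (punchIn-transpose-adjacent j l)

punchIn-punchIn-transpose : ∀ {n} (j : Fin (suc (suc n))) (l : Fin (suc n)) (s : Fin n) →
  punchIn j (punchIn l s) ≡ punchIn (punchIn j l) (punchIn (punchOut′ (punchIn j l) j) s)
punchIn-punchIn-transpose {suc n} zero    l       s       = ≡.refl
punchIn-punchIn-transpose         (suc j) zero    s       = ≡.refl
punchIn-punchIn-transpose {suc n} (suc j) (suc l) zero    = ≡.refl
punchIn-punchIn-transpose {suc n} (suc j) (suc l) (suc s) = ≡.cong suc (punchIn-punchIn-transpose j l s)

swapAdjacent : ∀ {n} → Fin n → Fin (suc n) → Fin (suc n)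
swapAdjacent zero    zero          = suc zero
swapAdjacent zero    (suc zero)    = zero
swapAdjacent zero    (suc (suc x)) = suc (suc x)
swapAdjacent (suc q) zero          = zero
swapAdjacent (suc q) (suc x)       = suc (swapAdjacent q x)

swapAdjacent-≗ : ∀ {n a} {X : Set a} (q : Fin n) (I : Fin (suc n) → X) →
                 I (Fin.inject₁ q) ≡ I (suc q) → I ∘ swapAdjacent q ≗ I
swapAdjacent-≗ zero    I e zero          = ≡.sym e
swapAdjacent-≗ zero    I e (suc zero)    = e
swapAdjacent-≗ zero    I e (suc (suc a)) = ≡.refl
swapAdjacent-≗ (suc q) I e zero          = ≡.refl
swapAdjacent-≗ (suc q) I e (suc a)       = swapAdjacent-≗ q (I ∘ suc) e a

upperBound : ∀ {m} → (Fin m → ℕ) → ℕ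
upperBound {zero}  σ = 0
upperBound {suc m} σ = σ zero ℕ.+ upperBound (σ ∘ suc)

≤-upperBound : ∀ {m} (σ : Fin m → ℕ) a → σ a ℕ.≤ upperBound σ
≤-upperBound σ zero    = ℕₚ.m≤m+n _ _
≤-upperBound σ (suc a) = ℕₚ.≤-trans (≤-upperBound (σ ∘ suc) a) (ℕₚ.m≤n+m _ _)

pred-<-suc : ∀ {x K} → 0 ℕ.< x → x ℕ.< suc K → ℕ.pred x ℕ.< K
pred-<-suc {suc x} _ x<1+K = ℕₚ.≤-pred x<1+K

zero-or-positive : ∀ x → x ≡ 0 ⊎ 0 ℕ.< x
zero-or-positive zero    = inj₁ ≡.refl
zero-or-positive (suc x) = inj₂ (s≤s z≤n)

module _ {c ℓ₁ ℓ₂} (OR : OrderedCommutativeRing c ℓ₁ ℓ₂) where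
  open OrderedCommutativeRing OR hiding (zero)
  open import Algebra.Properties.Ring ring
    using (-‿distribˡ-*; -‿distribʳ-*; -‿involutive; -0#≈0#; +-cancelʳ; -1*x≈-x)
  import Algebra.Properties.CommutativeSemigroup as CommutativeSemigroupProperties
  open CommutativeSemigroupProperties +-commutativeSemigroup using () renaming (interchange to +-interchange)
  open CommutativeSemigroupProperties *-commutativeSemigroup using () renaming (interchange to *-interchange)
  open import Relation.Binary.Reasoning.Setoid setoid
  module ≤ = IsTotalOrder isTotalOrder

  0≤+ : ∀ {a b} → 0# ≤ a → 0# ≤ b → 0# ≤ (a + b)
  0≤+ {a} {b} 0≤a 0≤b = ≤.trans 0≤b (≤.trans (≤.reflexive (sym (+-identityˡ b))) (+-mono-≤ b 0≤a))

  x+x≈0⇒x≈0 : ∀ {x} → x + x ≈ 0# → x ≈ 0#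
  x+x≈0⇒x≈0 {x} x+x≈0 with ≤.total 0# x
  ... | inj₁ 0≤x = ≤.antisym
    (≤.trans (≤.reflexive (sym (+-identityˡ x))) (≤.trans (+-mono-≤ x 0≤x) (≤.reflexive x+x≈0))) 0≤x
  ... | inj₂ x≤0 = ≤.antisym x≤0
    (≤.trans (≤.reflexive (sym x+x≈0)) (≤.trans (+-mono-≤ x x≤0) (≤.reflexive (+-identityˡ x))))

  x≈-x⇒x≈0 : ∀ {x} → x ≈ - x → x ≈ 0#
  x≈-x⇒x≈0 {x} x≈-x = x+x≈0⇒x≈0 (trans (+-congˡ x≈-x) (-‿inverseʳ x))

  0≤1 : 0# ≤ 1#
  0≤1 with ≤.total 0# 1#
  ... | inj₁ 0≤1 = 0≤1
  ... | inj₂ 1≤0 = ≤.trans (*-nonneg 0≤-1 0≤-1) (≤.reflexive (trans (-1*x≈-x (- 1#)) (-‿involutive 1#)))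
    where
    0≤-1 : 0# ≤ (- 1#)
    0≤-1 = ≤.trans (≤.reflexive (sym (-‿inverseʳ 1#)))
                   (≤.trans (+-mono-≤ (- 1#) 1≤0) (≤.reflexive (+-identityˡ (- 1#))))

  -- Finite sums as linear functionals

  Σ< : ℕ → (ℕ → Carrier) → Carrier
  Σ< = sumTo OR

  ΣFin : (n : ℕ) → (Fin n → Carrier) → Carrier
  ΣFin = sumFin OR

  when : ∀ {p} {P : Set p} → Dec P → Carrier → Carrier
  when (yes _) x = x
  when (no _)  _ = 0#

  Σ-between : ℕ → ℕ → (ℕ → Carrier) → Carrier
  Σ-between lo N f = Σ< N (λ i → when (lo ℕ.≤? i) (f i))

  module _ {p} {P : Set p} where

    when-yes : ∀ (d : Dec P) {x} → P → when d x ≈ x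
    when-yes (yes _) _ = refl
    when-yes (no ¬p) p = ⊥-elim (¬p p)

    when-no : ∀ (d : Dec P) {x} → ¬ P → when d x ≈ 0#
    when-no (yes p) ¬p = ⊥-elim (¬p p)
    when-no (no _)  _  = refl

    when-cong : ∀ (d : Dec P) {x y} → x ≈ y → when d x ≈ when d y
    when-cong (yes _) x≈y = x≈y
    when-cong (no _)  _   = refl

    when-0 : ∀ (d : Dec P) → when d 0# ≈ 0#
    when-0 (yes _) = refl
    when-0 (no _)  = refl

    when-+ : ∀ (d : Dec P) x y → when d (x + y) ≈ when d x + when d y
    when-+ (yes _) x y = refl
    when-+ (no _)  x y = sym (+-identityʳ 0#)

    when-*ˡ : ∀ (d : Dec P) a x → when d (a * x) ≈ a * when d x
    when-*ˡ (yes _) a x = refl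
    when-*ˡ (no _)  a x = sym (zeroʳ a)

  record Linear {X : Set} (L : (X → Carrier) → Carrier) : Set (c ⊔ ℓ₁) where
    field
      linear-cong : ∀ {f g} → (∀ x → f x ≈ g x) → L f ≈ L g
      linear-+    : ∀ f g → L (λ x → f x + g x) ≈ L f + L g
      linear-0    : L (λ _ → 0#) ≈ 0#
      linear-*ˡ   : ∀ a f → L (λ x → a * f x) ≈ a * L f
  open Linear

  module _ {X : Set} where

    0-linear : Linear {X} (λ _ → 0#)
    0-linear = record
      { linear-cong = λ _ → refl
      ; linear-+    = λ _ _ → sym (+-identityʳ 0#)
      ; linear-0    = refl
      ; linear-*ˡ   = λ a _ → sym (zeroʳ a)
      }

    evaluation-linear : ∀ x → Linear {X} (λ f → f x)
    evaluation-linear x = record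
      { linear-cong = λ f≈g → f≈g x
      ; linear-+    = λ _ _ → refl
      ; linear-0    = refl
      ; linear-*ˡ   = λ _ _ → refl
      }

    +-linear : ∀ {L M} → Linear {X} L → Linear M → Linear (λ f → L f + M f)
    +-linear L M = record
      { linear-cong = λ f≈g → +-cong (linear-cong L f≈g) (linear-cong M f≈g)
      ; linear-+    = λ f g → trans (+-cong (linear-+ L f g) (linear-+ M f g)) (+-interchange _ _ _ _)
      ; linear-0    = trans (+-cong (linear-0 L) (linear-0 M)) (+-identityʳ 0#)
      ; linear-*ˡ   = λ a f → trans (+-cong (linear-*ˡ L a f) (linear-*ˡ M a f)) (sym (distribˡ a _ _))
      }

    module _ {L : (X → Carrier) → Carrier} (lin : Linear L) where

      linear-*ʳ : ∀ a f → L (λ x → f x * a) ≈ L f * a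
      linear-*ʳ a f = trans (linear-cong lin (λ x → *-comm (f x) a)) (trans (linear-*ˡ lin a f) (*-comm a (L f)))

      linear-‿ : ∀ f → L (λ x → - f x) ≈ - L f
      linear-‿ f = begin
        L (λ x → - f x)        ≈⟨ linear-cong lin (λ x → sym (-1*x≈-x (f x))) ⟩
        L (λ x → - 1# * f x)   ≈⟨ linear-*ˡ lin (- 1#) f ⟩
        - 1# * L f             ≈⟨ -1*x≈-x (L f) ⟩
        - L f                  ∎

      linear-zero : ∀ f → (∀ x → f x ≈ 0#) → L f ≈ 0#
      linear-zero f f≈0 = trans (linear-cong lin f≈0) (linear-0 lin)

      linear-when : ∀ {p} {P : Set p} (d : Dec P) f → L (λ x → when d (f x)) ≈ when d (L f)
      linear-when (yes _) f = refl
      linear-when (no _)  f = linear-0 lin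

  ∘-linear : ∀ {X Y : Set} {L : (X → Carrier) → Carrier} (σ : X → Y) →
             Linear L → Linear (λ (f : Y → Carrier) → L (f ∘ σ))
  ∘-linear σ L = record
    { linear-cong = λ f≈g → linear-cong L (λ x → f≈g (σ x))
    ; linear-+    = λ f g → linear-+ L (f ∘ σ) (g ∘ σ)
    ; linear-0    = linear-0 L
    ; linear-*ˡ   = λ a f → linear-*ˡ L a (f ∘ σ)
    }

  linear-compose : ∀ {X Y : Set} {M : (X → Carrier) → Carrier} {L : X → (Y → Carrier) → Carrier} →
                   Linear M → (∀ x → Linear (L x)) → Linear (λ F → M (λ x → L x F))
  linear-compose M L = record
    { linear-cong = λ F≈G → linear-cong M (λ x → linear-cong (L x) F≈G)
    ; linear-+    = λ F G → trans (linear-cong M (λ x → linear-+ (L x) F G)) (linear-+ M _ _)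
    ; linear-0    = linear-zero M _ (λ x → linear-0 (L x))
    ; linear-*ˡ   = λ a F → trans (linear-cong M (λ x → linear-*ˡ (L x) a F)) (linear-*ˡ M a _)
    }

  Σ<-linear : ∀ N → Linear (Σ< N)
  Σ<-linear zero    = 0-linear
  Σ<-linear (suc N) = +-linear (Σ<-linear N) (evaluation-linear N)

  ΣFin-linear : ∀ n → Linear (ΣFin n)
  ΣFin-linear zero    = 0-linear
  ΣFin-linear (suc n) = +-linear (evaluation-linear zero) (∘-linear suc (ΣFin-linear n))

  Σ-between-linear : ∀ lo N → Linear (Σ-between lo N)
  Σ-between-linear lo N = record
    { linear-cong = λ f≈g → linear-cong Σ<N (λ i → when-cong (lo ℕ.≤? i) (f≈g i))
    ; linear-+    = λ f g → trans (linear-cong Σ<N (λ i → when-+ (lo ℕ.≤? i) (f i) (g i))) (linear-+ Σ<N _ _)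
    ; linear-0    = trans (linear-cong Σ<N (λ i → when-0 (lo ℕ.≤? i))) (linear-0 Σ<N)
    ; linear-*ˡ   = λ a f → trans (linear-cong Σ<N (λ i → when-*ˡ (lo ℕ.≤? i) a (f i))) (linear-*ˡ Σ<N a _)
    }
    where Σ<N = Σ<-linear N

  module _ {X : Set} {L : (X → Carrier) → Carrier} (lin : Linear L) where

    linear-Σ< : ∀ N (f : X → ℕ → Carrier) → L (λ x → Σ< N (f x)) ≈ Σ< N (λ i → L (λ x → f x i))
    linear-Σ< zero    f = linear-0 lin
    linear-Σ< (suc N) f = trans (linear-+ lin _ _) (+-congʳ (linear-Σ< N f))

    linear-ΣFin : ∀ n (f : X → Fin n → Carrier) → L (λ x → ΣFin n (f x)) ≈ ΣFin n (λ i → L (λ x → f x i))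
    linear-ΣFin zero    f = linear-0 lin
    linear-ΣFin (suc n) f = trans (linear-+ lin _ _) (+-congˡ (linear-ΣFin n (λ x → f x ∘ suc)))

    linear-Σ-between : ∀ lo N (f : X → ℕ → Carrier) →
      L (λ x → Σ-between lo N (f x)) ≈ Σ-between lo N (λ i → L (λ x → f x i))
    linear-Σ-between lo N f =
      trans (linear-Σ< N _) (linear-cong (Σ<-linear N) (λ i → linear-when lin (lo ℕ.≤? i) (λ x → f x i)))

  Σ-between-cong : ∀ lo N {f g} → (∀ i → lo ℕ.≤ i → i ℕ.< N → f i ≈ g i) →
                   Σ-between lo N f ≈ Σ-between lo N g
  Σ-between-cong lo zero          f≈g = refl
  Σ-between-cong lo (suc N) {f} {g} f≈g =
    +-cong (Σ-between-cong lo N (λ i lo≤i i<N → f≈g i lo≤i (ℕₚ.m≤n⇒m≤1+n i<N))) (last (lo ℕ.≤? N))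
    where
    last : (d : Dec (lo ℕ.≤ N)) → when d (f N) ≈ when d (g N)
    last (yes lo≤N) = f≈g N lo≤N (ℕₚ.n<1+n N)
    last (no _)     = refl

  Σ-between-empty : ∀ lo N f → N ℕ.≤ lo → Σ-between lo N f ≈ 0#
  Σ-between-empty lo zero    f _    = refl
  Σ-between-empty lo (suc N) f N<lo =
    trans (+-cong (Σ-between-empty lo N f (ℕₚ.<⇒≤ N<lo)) (when-no (lo ℕ.≤? N) (ℕₚ.<⇒≱ N<lo))) (+-identityʳ 0#)

  Σ-between-0 : ∀ N f → Σ-between 0 N f ≈ Σ< N f
  Σ-between-0 N f = linear-cong (Σ<-linear N) (λ i → when-yes (0 ℕ.≤? i) z≤n)

  Σ-between-last : ∀ lo N f → lo ℕ.≤ N → Σ-between lo (suc N) f ≈ Σ-between lo N f + f N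
  Σ-between-last lo N f lo≤N = +-congˡ (when-yes (lo ℕ.≤? N) lo≤N)

  when-Σ-between : ∀ lo N f → when (lo ℕ.≤? N) (Σ-between lo N f) ≈ Σ-between lo N f
  when-Σ-between lo N f with lo ℕ.≤? N
  ... | yes _    = refl
  ... | no lo≰N = sym (Σ-between-empty lo N f (ℕₚ.<⇒≤ (ℕₚ.≰⇒> lo≰N)))

  Σ-between-split : ∀ lo j N f → lo ℕ.≤ j → j ℕ.< N →
                    Σ-between lo N f ≈ (Σ-between lo j f + f j) + Σ-between (suc j) N f
  Σ-between-split lo j (suc N) f lo≤j j<1+N with ℕₚ.m≤n⇒m<n∨m≡n (ℕₚ.≤-pred j<1+N)
  ... | inj₂ ≡.refl = begin
    Σ-between lo (suc j) f
      ≈⟨ Σ-between-last lo j f lo≤j ⟩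
    Σ-between lo j f + f j
      ≈⟨ sym (+-identityʳ _) ⟩
    (Σ-between lo j f + f j) + 0#
      ≈⟨ +-congˡ (sym (Σ-between-empty (suc j) (suc j) f ℕₚ.≤-refl)) ⟩
    (Σ-between lo j f + f j) + Σ-between (suc j) (suc j) f ∎
  ... | inj₁ j<N = begin
    Σ-between lo N f + when (lo ℕ.≤? N) (f N)
      ≈⟨ +-cong (Σ-between-split lo j N f lo≤j j<N)
                (when-yes (lo ℕ.≤? N) (ℕₚ.≤-trans lo≤j (ℕₚ.<⇒≤ j<N))) ⟩
    ((Σ-between lo j f + f j) + Σ-between (suc j) N f) + f N
      ≈⟨ +-assoc _ _ _ ⟩
    (Σ-between lo j f + f j) + (Σ-between (suc j) N f + f N)
      ≈⟨ +-congˡ (sym (Σ-between-last (suc j) N f j<N)) ⟩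
    (Σ-between lo j f + f j) + Σ-between (suc j) (suc N) f ∎

  Σ-between-triangle : ∀ lo N (K : ℕ → ℕ → Carrier) →
    Σ-between lo N (λ j → Σ-between lo j (λ i → K i j)) ≈ Σ-between lo N (λ i → Σ-between (suc i) N (K i))
  Σ-between-triangle lo zero    K = refl
  Σ-between-triangle lo (suc N) K = begin
    Σ-between lo N (λ j → Σ-between lo j (λ i → K i j)) + when (lo ℕ.≤? N) (Σ-between lo N (λ i → K i N))
      ≈⟨ +-cong (Σ-between-triangle lo N K) (when-Σ-between lo N (λ i → K i N)) ⟩
    Σ-between lo N (λ i → Σ-between (suc i) N (K i)) + Σ-between lo N (λ i → K i N)
      ≈⟨ sym (linear-+ (Σ-between-linear lo N) _ _) ⟩
    Σ-between lo N (λ i → Σ-between (suc i) N (K i) + K i N)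
      ≈⟨ Σ-between-cong lo N (λ i _ i<N → sym (Σ-between-last (suc i) N (K i) i<N)) ⟩
    Σ-between lo N (λ i → Σ-between (suc i) (suc N) (K i))
      ≈⟨ sym (+-identityʳ _) ⟩
    Σ-between lo N (λ i → Σ-between (suc i) (suc N) (K i)) + 0#
      ≈⟨ +-congˡ (sym (trans (when-cong (lo ℕ.≤? N) (Σ-between-empty (suc N) (suc N) (K N) ℕₚ.≤-refl))
                             (when-0 (lo ℕ.≤? N)))) ⟩
    Σ-between lo (suc N) (λ i → Σ-between (suc i) (suc N) (K i)) ∎

  Σ-between-triangle-≤ : ∀ lo N (K : ℕ → ℕ → Carrier) →
    Σ-between lo N (λ j → Σ-between lo (suc j) (λ i → K i j)) ≈ Σ-between lo N (λ i → Σ-between i N (K i))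
  Σ-between-triangle-≤ lo N K = begin
    Σ-between lo N (λ j → Σ-between lo (suc j) (λ i → K i j))
      ≈⟨ Σ-between-cong lo N (λ j lo≤j _ → Σ-between-last lo j (λ i → K i j) lo≤j) ⟩
    Σ-between lo N (λ j → Σ-between lo j (λ i → K i j) + K j j)
      ≈⟨ linear-+ (Σ-between-linear lo N) _ _ ⟩
    Σ-between lo N (λ j → Σ-between lo j (λ i → K i j)) + Σ-between lo N (λ j → K j j)
      ≈⟨ +-congʳ (Σ-between-triangle lo N K) ⟩
    Σ-between lo N (λ i → Σ-between (suc i) N (K i)) + Σ-between lo N (λ i → K i i)
      ≈⟨ +-comm _ _ ⟩
    Σ-between lo N (λ i → K i i) + Σ-between lo N (λ i → Σ-between (suc i) N (K i))
      ≈⟨ sym (linear-+ (Σ-between-linear lo N) _ _) ⟩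
    Σ-between lo N (λ i → K i i + Σ-between (suc i) N (K i))
      ≈⟨ Σ-between-cong lo N (λ i _ i<N → sym (split i i<N)) ⟩
    Σ-between lo N (λ i → Σ-between i N (K i)) ∎
    where
    split : ∀ i → i ℕ.< N → Σ-between i N (K i) ≈ K i i + Σ-between (suc i) N (K i)
    split i i<N = trans (Σ-between-split i i N (K i) ℕₚ.≤-refl i<N)
                        (+-congʳ (trans (+-congʳ (Σ-between-empty i i (K i) ℕₚ.≤-refl)) (+-identityˡ _)))

  Σ<-cong : ∀ N {f g} → (∀ i → i ℕ.< N → f i ≈ g i) → Σ< N f ≈ Σ< N g
  Σ<-cong N {f} {g} f≈g =
    trans (sym (Σ-between-0 N f)) (trans (Σ-between-cong 0 N (λ i _ → f≈g i)) (Σ-between-0 N g))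

  Σ<-first : ∀ N f → Σ< (suc N) f ≈ f 0 + Σ< N (f ∘ suc)
  Σ<-first zero    f = +-comm _ _
  Σ<-first (suc N) f = trans (+-congʳ (Σ<-first N f)) (+-assoc _ _ _)

  Σ<-vanishing-tail : ∀ a N f → a ℕ.≤ N → (∀ j → a ℕ.≤ j → f j ≈ 0#) → Σ< N f ≈ Σ< a f
  Σ<-vanishing-tail a zero    f z≤n   _   = refl
  Σ<-vanishing-tail a (suc N) f a≤1+N f≈0 with ℕₚ.m≤n⇒m<n∨m≡n a≤1+N
  ... | inj₂ ≡.refl = refl
  ... | inj₁ a<1+N  = trans
    (+-cong (Σ<-vanishing-tail a N f (ℕₚ.≤-pred a<1+N) f≈0) (f≈0 N (ℕₚ.≤-pred a<1+N))) (+-identityʳ _)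

  Σ<-shift : ∀ i K φ → Σ< K φ ≈ Σ-between i (i ℕ.+ K) (λ j → φ (j ∸ i))
  Σ<-shift i zero    φ = sym (Σ-between-empty i (i ℕ.+ 0) _ (ℕₚ.≤-reflexive (ℕₚ.+-identityʳ i)))
  Σ<-shift i (suc K) φ rewrite ℕₚ.+-suc i K = sym (trans
    (Σ-between-last i (i ℕ.+ K) _ (ℕₚ.m≤m+n i K))
    (+-cong (sym (Σ<-shift i K φ)) (reflexive (≡.cong φ (ℕₚ.m+n∸m≡n i K)))))

  sign : ℕ → Carrier → Carrier
  sign = signed OR

  sign-as-* : ∀ n x → sign n x ≈ sign n 1# * x
  sign-as-* zero    x = sym (*-identityˡ x)
  sign-as-* (suc n) x = trans (-‿cong (sign-as-* n x)) (-‿distribˡ-* _ _)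

  sign-cong : ∀ n {x y} → x ≈ y → sign n x ≈ sign n y
  sign-cong n x≈y = trans (sign-as-* n _) (trans (*-congˡ x≈y) (sym (sign-as-* n _)))

  sign-‿ : ∀ n x → sign n (- x) ≈ - sign n x
  sign-‿ n x = trans (sign-as-* n _) (trans (sym (-‿distribʳ-* _ _)) (-‿cong (sym (sign-as-* n x))))

  sign-*ˡ : ∀ n x y → sign n (x * y) ≈ x * sign n y
  sign-*ˡ n x y = begin
    sign n (x * y)      ≈⟨ sign-as-* n _ ⟩
    sign n 1# * (x * y) ≈⟨ sym (*-assoc _ _ _) ⟩
    sign n 1# * x * y   ≈⟨ *-congʳ (*-comm _ _) ⟩
    x * sign n 1# * y   ≈⟨ *-assoc _ _ _ ⟩
    x * (sign n 1# * y) ≈⟨ *-congˡ (sym (sign-as-* n y)) ⟩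
    x * sign n y        ∎

  sign-*ʳ : ∀ n x y → sign n (x * y) ≈ sign n x * y
  sign-*ʳ n x y = trans (sign-as-* n _) (trans (sym (*-assoc _ _ _)) (*-congʳ (sym (sign-as-* n x))))

  sign-0 : ∀ n → sign n 0# ≈ 0#
  sign-0 n = trans (sign-as-* n _) (zeroʳ _)

  sign-sign : ∀ a b x → sign a (sign b x) ≈ sign (a ℕ.+ b) x
  sign-sign zero    b x = refl
  sign-sign (suc a) b x = -‿cong (sign-sign a b x)

  sign-adjacent : ∀ s t {x y} → Adjacent s t → x ≈ y → sign s x ≈ - sign t y
  sign-adjacent s .(suc s) (inj₁ ≡.refl) x≈y = sym (trans (-‿involutive _) (sign-cong s (sym x≈y)))
  sign-adjacent .(suc t) t (inj₂ ≡.refl) x≈y = -‿cong (sign-cong t x≈y)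

  linear-sign : ∀ k {X : Set} {L : (X → Carrier) → Carrier} → Linear L → ∀ f →
                sign k (L f) ≈ L (λ x → sign k (f x))
  linear-sign k lin f =
    trans (sign-as-* k _) (trans (sym (linear-*ˡ lin _ f)) (linear-cong lin (λ x → sym (sign-as-* k (f x)))))

  -- Determinants

  det′ : (m : ℕ) → (Fin m → Fin m → Carrier) → Carrier
  det′ = det OR

  minor : ∀ {m} → (Fin (suc m) → Fin (suc m) → Carrier) → Fin (suc m) → Fin m → Fin m → Carrier
  minor A j r s = A (suc r) (punchIn j s)

  laplaceTerm : ∀ {m} → (Fin (suc m) → Fin (suc m) → Carrier) → Fin (suc m) → Carrier
  laplaceTerm {m} A j = sign (toℕ j) (A zero j * det′ m (minor A j))

  det-cong : ∀ n {A B : Fin n → Fin n → Carrier} → (∀ a b → A a b ≈ B a b) → det′ n A ≈ det′ n B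
  det-cong zero    A≈B = refl
  det-cong (suc n) A≈B = linear-cong (ΣFin-linear (suc n)) (λ j → sign-cong (toℕ j)
    (*-cong (A≈B zero j) (det-cong n (λ r s → A≈B (suc r) (punchIn j s)))))

  ΣFin-punchIn : ∀ {n} (j : Fin (suc n)) (g : Fin (suc n) → Carrier) → ΣFin n (g ∘ punchIn j) + g j ≈ ΣFin (suc n) g
  ΣFin-punchIn         zero    g = +-comm _ _
  ΣFin-punchIn {suc n} (suc j) g = trans (+-assoc _ _ _) (+-congˡ (ΣFin-punchIn j (g ∘ suc)))

  Σ-offDiagonal : ∀ {n} → (Fin (suc n) → Fin (suc n) → Carrier) → Carrier
  Σ-offDiagonal {n} f = ΣFin (suc n) (λ j → ΣFin n (λ l → f j (punchIn j l)))

  Σ-offDiagonal-transpose : ∀ {n} (f : Fin (suc n) → Fin (suc n) → Carrier) →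
                            Σ-offDiagonal f ≈ Σ-offDiagonal (λ j k → f k j)
  Σ-offDiagonal-transpose {n} f = +-cancelʳ (ΣFin (suc n) (λ j → f j j)) _ _ (begin
    Σ-offDiagonal f + ΣFin (suc n) (λ j → f j j)
      ≈⟨ sym (linear-+ Σₙ₊₁ (λ j → ΣFin n (λ l → f j (punchIn j l))) (λ j → f j j)) ⟩
    ΣFin (suc n) (λ j → ΣFin n (λ l → f j (punchIn j l)) + f j j)
      ≈⟨ linear-cong Σₙ₊₁ (λ j → ΣFin-punchIn j (f j)) ⟩
    ΣFin (suc n) (λ j → ΣFin (suc n) (f j))
      ≈⟨ linear-ΣFin Σₙ₊₁ (suc n) f ⟩
    ΣFin (suc n) (λ k → ΣFin (suc n) (λ j → f j k))
      ≈⟨ sym (linear-cong Σₙ₊₁ (λ j → ΣFin-punchIn j (λ k → f k j))) ⟩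
    ΣFin (suc n) (λ j → ΣFin n (λ l → f (punchIn j l) j) + f j j)
      ≈⟨ linear-+ Σₙ₊₁ (λ j → ΣFin n (λ l → f (punchIn j l) j)) (λ j → f j j) ⟩
    Σ-offDiagonal (λ j k → f k j) + ΣFin (suc n) (λ j → f j j) ∎)
    where Σₙ₊₁ = ΣFin-linear (suc n)

  det-expand₂ : ∀ {n} (A : Fin (suc (suc n)) → Fin (suc (suc n)) → Carrier) →
    det′ (suc (suc n)) A ≈ ΣFin (suc (suc n)) (λ j → ΣFin (suc n) (λ l →
      sign (toℕ j) (sign (toℕ l) ((A zero j * A (suc zero) (punchIn j l)) * det′ n (minor (minor A j) l)))))
  det-expand₂ {n} A = linear-cong (ΣFin-linear (suc (suc n))) λ j → begin
    sign (toℕ j) (A zero j * ΣFin (suc n) (λ l → sign (toℕ l) (A (suc zero) (punchIn j l) * D j l)))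
      ≈⟨ sign-cong (toℕ j) (sym (linear-*ˡ (ΣFin-linear (suc n)) (A zero j)
           (λ l → sign (toℕ l) (A (suc zero) (punchIn j l) * D j l)))) ⟩
    sign (toℕ j) (ΣFin (suc n) (λ l → A zero j * sign (toℕ l) (A (suc zero) (punchIn j l) * D j l)))
      ≈⟨ sign-cong (toℕ j) (linear-cong (ΣFin-linear (suc n)) (λ l →
           trans (sym (sign-*ˡ (toℕ l) (A zero j) (A (suc zero) (punchIn j l) * D j l)))
                 (sign-cong (toℕ l) (sym (*-assoc (A zero j) (A (suc zero) (punchIn j l)) (D j l)))))) ⟩
    sign (toℕ j) (ΣFin (suc n) (λ l → sign (toℕ l) ((A zero j * A (suc zero) (punchIn j l)) * D j l)))
      ≈⟨ linear-sign (toℕ j) (ΣFin-linear (suc n))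
           (λ l → sign (toℕ l) ((A zero j * A (suc zero) (punchIn j l)) * D j l)) ⟩
    ΣFin (suc n) (λ l → sign (toℕ j) (sign (toℕ l) ((A zero j * A (suc zero) (punchIn j l)) * D j l))) ∎
    where
    D : Fin (suc (suc n)) → Fin (suc n) → Carrier
    D j l = det′ n (minor (minor A j) l)

  -- Each term of the expansion of the row-swapped matrix is minus the term of the expansion
  -- of A with the two columns exchanged, so the sums agree up to transposing the index pair.
  det-swap₀₁ : ∀ n (A : Fin (suc (suc n)) → Fin (suc (suc n)) → Carrier) →
               det′ (suc (suc n)) (A ∘ swapAdjacent zero) ≈ - det′ (suc (suc n)) A
  det-swap₀₁ n A = begin
    det′ (suc (suc n)) (A ∘ swapAdjacent zero)
      ≈⟨ det-expand₂ (A ∘ swapAdjacent zero) ⟩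
    ΣFin (suc (suc n)) (λ j → ΣFin (suc n) (λ l →
      sign (toℕ j) (sign (toℕ l) ((A (suc zero) j * A zero (punchIn j l)) * det′ n (minor (minor A j) l)))))
      ≈⟨ linear-cong Σₙ₊₂ (λ j → linear-cong Σₙ₊₁ (λ l → swapped-term j l)) ⟩
    ΣFin (suc (suc n)) (λ j → ΣFin (suc n) (λ l → - term (punchIn j l) j))
      ≈⟨ trans (linear-cong Σₙ₊₂ (λ j → linear-‿ Σₙ₊₁ (λ l → term (punchIn j l) j)))
               (linear-‿ Σₙ₊₂ (λ j → ΣFin (suc n) (λ l → term (punchIn j l) j))) ⟩
    - Σ-offDiagonal (λ j k → term k j)
      ≈⟨ -‿cong (sym (Σ-offDiagonal-transpose term)) ⟩
    - Σ-offDiagonal term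
      ≈⟨ -‿cong (sym (trans (det-expand₂ A)
           (linear-cong Σₙ₊₂ (λ j → linear-cong Σₙ₊₁ (λ l → term-punchIn j l))))) ⟩
    - det′ (suc (suc n)) A ∎
    where
    Σₙ₊₂ = ΣFin-linear (suc (suc n))
    Σₙ₊₁ = ΣFin-linear (suc n)
    term : Fin (suc (suc n)) → Fin (suc (suc n)) → Carrier
    term j k = sign (toℕ j) (sign (toℕ (punchOut′ j k))
      ((A zero j * A (suc zero) k) * det′ n (minor (minor A j) (punchOut′ j k))))
    term-punchIn : ∀ j l → sign (toℕ j) (sign (toℕ l) ((A zero j * A (suc zero) (punchIn j l)) *
                                         det′ n (minor (minor A j) l))) ≈ term j (punchIn j l)
    term-punchIn j l = reflexive (≡.cong (λ t → sign (toℕ j) (sign (toℕ t)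
      ((A zero j * A (suc zero) (punchIn j l)) * det′ n (minor (minor A j) t)))) (≡.sym (punchOut′-punchIn j l)))
    swapped-term : ∀ j l → sign (toℕ j) (sign (toℕ l) ((A (suc zero) j * A zero (punchIn j l)) *
                                         det′ n (minor (minor A j) l))) ≈ - term (punchIn j l) j
    swapped-term j l = begin
      sign (toℕ j) (sign (toℕ l) ((A (suc zero) j * A zero k) * det′ n (minor (minor A j) l)))
        ≈⟨ sign-sign (toℕ j) (toℕ l) _ ⟩
      sign (toℕ j ℕ.+ toℕ l) ((A (suc zero) j * A zero k) * det′ n (minor (minor A j) l))
        ≈⟨ sign-adjacent _ _ (punchIn-transpose-adjacent j l) (*-cong (*-comm _ _)
             (det-cong n (λ r s → reflexive (≡.cong (A (suc (suc r))) (punchIn-punchIn-transpose j l s))))) ⟩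
      - sign (toℕ k ℕ.+ toℕ (punchOut′ k j))
             ((A zero k * A (suc zero) j) * det′ n (minor (minor A k) (punchOut′ k j)))
        ≈⟨ -‿cong (sym (sign-sign (toℕ k) (toℕ (punchOut′ k j)) _)) ⟩
      - term k j ∎
      where k = punchIn j l

  det-swapAdjacent : ∀ n (q : Fin n) (A : Fin (suc n) → Fin (suc n) → Carrier) →
                     det′ (suc n) (A ∘ swapAdjacent q) ≈ - det′ (suc n) A
  det-swapAdjacent (suc n) zero    A = det-swap₀₁ n A
  det-swapAdjacent (suc n) (suc q) A = trans
    (linear-cong (ΣFin-linear (suc (suc n))) (λ j → trans
      (sign-cong (toℕ j) (trans (*-congˡ (det-swapAdjacent n q (minor A j)))
                                (sym (-‿distribʳ-* (A zero j) (det′ (suc n) (minor A j))))))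
      (sign-‿ (toℕ j) (A zero j * det′ (suc n) (minor A j)))))
    (linear-‿ (ΣFin-linear (suc (suc n))) (laplaceTerm A))

  det-repeatedAdjacent : ∀ n (q : Fin n) (A : Fin (suc n) → Fin (suc n) → Carrier) →
                         A (Fin.inject₁ q) ≡ A (suc q) → det′ (suc n) A ≈ 0#
  det-repeatedAdjacent n q A e = x≈-x⇒x≈0 (trans
    (det-cong (suc n) (λ a b → reflexive (≡.cong-app (≡.sym (swapAdjacent-≗ q A e a)) b)))
    (det-swapAdjacent n q A))

  det-zero-first-row : ∀ n (A : Fin (suc n) → Fin (suc n) → Carrier) → (∀ b → A zero b ≈ 0#) →
                       det′ (suc n) A ≈ 0#
  det-zero-first-row n A A₀≈0 = linear-zero (ΣFin-linear (suc n)) (laplaceTerm A)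
    (λ j → trans (sign-cong (toℕ j) (trans (*-congʳ (A₀≈0 j)) (zeroˡ _))) (sign-0 (toℕ j)))

  det-zero-first-column : ∀ n (A : Fin (suc n) → Fin (suc n) → Carrier) → (∀ a → A a zero ≈ 0#) →
                          det′ (suc n) A ≈ 0#
  det-zero-first-column zero    A A·₀≈0 = trans (+-identityʳ _) (trans (*-congʳ (A·₀≈0 zero)) (zeroˡ _))
  det-zero-first-column (suc n) A A·₀≈0 = trans
    (+-cong (trans (*-congʳ (A·₀≈0 zero)) (zeroˡ _))
            (linear-zero (ΣFin-linear (suc n)) (laplaceTerm A ∘ suc) (λ j → trans
              (sign-cong (suc (toℕ j)) (trans (*-congˡ (det-zero-first-column n (minor A (suc j)) (A·₀≈0 ∘ suc)))
                                              (zeroʳ _)))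
              (sign-0 (suc (toℕ j))))))
    (+-identityʳ 0#)

  det-unit-first-row : ∀ n (A : Fin (suc n) → Fin (suc n) → Carrier) → A zero zero ≈ 1# →
                       (∀ b → A zero (suc b) ≈ 0#) → det′ (suc n) A ≈ det′ n (minor A zero)
  det-unit-first-row n A A₀₀≈1 A₀ₛ≈0 = trans
    (+-cong (trans (*-congʳ A₀₀≈1) (*-identityˡ _))
            (linear-zero (ΣFin-linear n) (laplaceTerm A ∘ suc) (λ j → trans
              (sign-cong (suc (toℕ j)) (trans (*-congʳ (A₀ₛ≈0 j)) (zeroˡ _)))
              (sign-0 (suc (toℕ j))))))
    (+-identityʳ _)

  -- The Cauchy–Binet formula

  -- Σ-increasing m lo N F sums F over the strictly increasing m-tuples with entries in [lo, N).
  Σ-increasing : (m : ℕ) → ℕ → ℕ → ((Fin m → ℕ) → Carrier) → Carrier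
  Σ-increasing zero    lo N F = F []
  Σ-increasing (suc m) lo N F = Σ-between lo N (λ i → Σ-increasing m (suc i) N (λ I → F (i ∷ I)))

  IncreasingIn : (m : ℕ) → ℕ → ℕ → (Fin m → ℕ) → Set
  IncreasingIn zero    lo N I = ⊤
  IncreasingIn (suc m) lo N I = lo ℕ.≤ I zero × I zero ℕ.< N × IncreasingIn m (suc (I zero)) N (I ∘ suc)

  IncreasingIn-lower : ∀ m lo N I → IncreasingIn m lo N I → ∀ a → lo ℕ.≤ I a
  IncreasingIn-lower (suc m) lo N I (lo≤I₀ , _ , inc) zero    = lo≤I₀
  IncreasingIn-lower (suc m) lo N I (lo≤I₀ , _ , inc) (suc a) =
    ℕₚ.≤-trans lo≤I₀ (ℕₚ.<⇒≤ (IncreasingIn-lower m _ N (I ∘ suc) inc a))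

  IncreasingIn⇒StrictlyIncreasing : ∀ m lo N I → IncreasingIn m lo N I → StrictlyIncreasing OR I
  IncreasingIn⇒StrictlyIncreasing (suc m) lo N I (_ , _ , inc) zero    (suc b) _ =
    IncreasingIn-lower m _ N (I ∘ suc) inc b
  IncreasingIn⇒StrictlyIncreasing (suc m) lo N I (_ , _ , inc) (suc a) (suc b) (s≤s a<b) =
    IncreasingIn⇒StrictlyIncreasing m _ N (I ∘ suc) inc a b a<b

  Σ-increasing-linear : ∀ m lo N → Linear (Σ-increasing m lo N)
  Σ-increasing-linear zero    lo N = evaluation-linear []
  Σ-increasing-linear (suc m) lo N =
    linear-compose (Σ-between-linear lo N) (λ i → ∘-linear (i ∷_) (Σ-increasing-linear m (suc i) N))

  Σ-increasing-cong : ∀ m lo N {F G} → (∀ I → IncreasingIn m lo N I → F I ≈ G I) →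
                      Σ-increasing m lo N F ≈ Σ-increasing m lo N G
  Σ-increasing-cong zero    lo N F≈G = F≈G [] tt
  Σ-increasing-cong (suc m) lo N F≈G = Σ-between-cong lo N (λ i lo≤i i<N →
    Σ-increasing-cong m (suc i) N (λ I inc → F≈G (i ∷ I) (lo≤i , i<N , inc)))

  Σ-between-nonneg : ∀ lo N {f} → (∀ i → lo ℕ.≤ i → i ℕ.< N → 0# ≤ f i) → 0# ≤ Σ-between lo N f
  Σ-between-nonneg lo zero    0≤f = ≤.refl
  Σ-between-nonneg lo (suc N) {f} 0≤f =
    0≤+ (Σ-between-nonneg lo N (λ i lo≤i i<N → 0≤f i lo≤i (ℕₚ.m≤n⇒m≤1+n i<N))) (last (lo ℕ.≤? N))
    where
    last : (d : Dec (lo ℕ.≤ N)) → 0# ≤ when d (f N)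
    last (yes lo≤N) = 0≤f N lo≤N (ℕₚ.n<1+n N)
    last (no _)     = ≤.refl

  Σ-increasing-nonneg : ∀ m lo N {F} → (∀ I → IncreasingIn m lo N I → 0# ≤ F I) → 0# ≤ Σ-increasing m lo N F
  Σ-increasing-nonneg zero    lo N 0≤F = 0≤F [] tt
  Σ-increasing-nonneg (suc m) lo N 0≤F = Σ-between-nonneg lo N (λ i lo≤i i<N →
    Σ-increasing-nonneg m (suc i) N (λ I inc → 0≤F (i ∷ I) (lo≤i , i<N , inc)))

  -- Σ-insertions k lo N J G sums G (I, p) over the ways of inserting a value into the
  -- increasing tuple J so that the result I is increasing and the new value sits at position p.
  Σ-insertions : (k : ℕ) → ℕ → ℕ → (Fin k → ℕ) → ((Fin (suc k) → ℕ) → Fin (suc k) → Carrier) → Carrier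
  Σ-insertions zero    lo N J G = Σ-between lo N (λ i → G (i ∷ J) zero)
  Σ-insertions (suc k) lo N J G = Σ-between lo (J zero) (λ i → G (i ∷ J) zero)
    + Σ-insertions k (suc (J zero)) N (J ∘ suc) (λ I p → G (J zero ∷ I) (suc p))

  Σ-insertions-cong : ∀ k lo N J {G G′} → (∀ I p → G I p ≈ G′ I p) →
                      Σ-insertions k lo N J G ≈ Σ-insertions k lo N J G′
  Σ-insertions-cong zero    lo N J G≈G′ = linear-cong (Σ-between-linear lo N) (λ i → G≈G′ _ zero)
  Σ-insertions-cong (suc k) lo N J G≈G′ =
    +-cong (linear-cong (Σ-between-linear lo (J zero)) (λ i → G≈G′ _ zero))
           (Σ-insertions-cong k (suc (J zero)) N (J ∘ suc) (λ I p → G≈G′ _ (suc p)))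

  Σ-increasing-insertions : ∀ m lo N G →
    Σ-increasing m lo N (λ J → Σ-insertions m lo N J G) ≈ Σ-increasing (suc m) lo N (λ I → ΣFin (suc m) (G I))
  Σ-increasing-insertions zero    lo N G = linear-cong (Σ-between-linear lo N) (λ i → sym (+-identityʳ _))
  Σ-increasing-insertions (suc m) lo N G = begin
    Σ-increasing (suc m) lo N (λ J → Σ-insertions (suc m) lo N J G)
      ≈⟨ linear-+ (Σ-increasing-linear (suc m) lo N) insertFirst insertLater ⟩
    Σ-increasing (suc m) lo N insertFirst + Σ-increasing (suc m) lo N insertLater
      ≈⟨ +-cong first later ⟩
    Σ-increasing (suc (suc m)) lo N (λ I → G I zero) +
    Σ-increasing (suc (suc m)) lo N (λ I → ΣFin (suc m) (G I ∘ suc))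
      ≈⟨ sym (linear-+ (Σ-increasing-linear (suc (suc m)) lo N) (λ I → G I zero) (λ I → ΣFin (suc m) (G I ∘ suc))) ⟩
    Σ-increasing (suc (suc m)) lo N (λ I → ΣFin (suc (suc m)) (G I)) ∎
    where
    insertFirst insertLater : (Fin (suc m) → ℕ) → Carrier
    insertFirst J = Σ-between lo (J zero) (λ i → G (i ∷ J) zero)
    insertLater J = Σ-insertions m (suc (J zero)) N (J ∘ suc) (λ I p → G (J zero ∷ I) (suc p))
    first : Σ-increasing (suc m) lo N insertFirst ≈ Σ-increasing (suc (suc m)) lo N (λ I → G I zero)
    first = trans
      (linear-cong (Σ-between-linear lo N) (λ j →
        linear-Σ-between (Σ-increasing-linear m (suc j) N) lo j (λ J i → G (i ∷ j ∷ J) zero)))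
      (Σ-between-triangle lo N (λ i j → Σ-increasing m (suc j) N (λ J → G (i ∷ j ∷ J) zero)))
    later : Σ-increasing (suc m) lo N insertLater ≈ Σ-increasing (suc (suc m)) lo N (λ I → ΣFin (suc m) (G I ∘ suc))
    later = linear-cong (Σ-between-linear lo N) (λ j →
      Σ-increasing-insertions m (suc j) N (λ I p → G (j ∷ I) (suc p)))

  RespectsPointwise : ∀ {n} → ((Fin n → ℕ) → Carrier) → Set ℓ₁
  RespectsPointwise Φ = ∀ {I J} → I ≗ J → Φ I ≈ Φ J

  record Alternating {n} (Φ : (Fin (suc n) → ℕ) → Carrier) : Set ℓ₁ where
    field
      resp-≗     : RespectsPointwise Φ
      swap-‿     : ∀ (q : Fin n) I → Φ (I ∘ swapAdjacent q) ≈ - Φ I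
      repeated-0 : ∀ (q : Fin n) I → I (Fin.inject₁ q) ≡ I (suc q) → Φ I ≈ 0#
  open Alternating

  Alternating-tail : ∀ {n} {Φ : (Fin (suc (suc n)) → ℕ) → Carrier} → Alternating Φ →
                     ∀ j → Alternating (λ I → - Φ (j ∷ I))
  Alternating-tail Φ-alt j = record
    { resp-≗     = λ I≗J → -‿cong (resp-≗ Φ-alt (λ { zero → ≡.refl ; (suc a) → I≗J a }))
    ; swap-‿     = λ q I → -‿cong (trans (resp-≗ Φ-alt (λ { zero → ≡.refl ; (suc a) → ≡.refl }))
                                         (swap-‿ Φ-alt (suc q) (j ∷ I)))
    ; repeated-0 = λ q I e → trans (-‿cong (repeated-0 Φ-alt (suc q) (j ∷ I) e)) -0#≈0#
    }

  -- Sorting the new index i into J: the terms with i ∈ J vanish, and moving i from the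
  -- front to its place p costs the sign (-1)^p.
  alternating-insert : ∀ k lo N {Φ : (Fin (suc k) → ℕ) → Carrier} → Alternating Φ →
    (W : ℕ → (Fin k → ℕ) → Carrier) → (∀ i → RespectsPointwise (W i)) →
    ∀ J → IncreasingIn k lo N J →
    Σ-between lo N (λ i → W i J * Φ (i ∷ J)) ≈
    Σ-insertions k lo N J (λ I p → sign (toℕ p) (W (I p) (I ∘ punchIn p) * Φ I))
  alternating-insert zero    lo N Φ-alt W W-resp J _ = refl
  alternating-insert (suc k) lo N {Φ} Φ-alt W W-resp J (lo≤j , j<N , inc) = begin
    Σ-between lo N F
      ≈⟨ Σ-between-split lo j N F lo≤j j<N ⟩
    (Σ-between lo j F + F j) + Σ-between (suc j) N F
      ≈⟨ +-cong (trans (+-congˡ Fj≈0) (+-identityʳ _)) (trans (Σ-between-cong (suc j) N later-term)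
           (alternating-insert k (suc j) N (Alternating-tail Φ-alt j) W′ W′-resp (J ∘ suc) inc)) ⟩
    Σ-between lo j F +
    Σ-insertions k (suc j) N (J ∘ suc) (λ I p → sign (toℕ p) (W′ (I p) (I ∘ punchIn p) * - Φ (j ∷ I)))
      ≈⟨ +-congˡ (Σ-insertions-cong k (suc j) N (J ∘ suc) reindex) ⟩
    Σ-insertions (suc k) lo N J (λ I p → sign (toℕ p) (W (I p) (I ∘ punchIn p) * Φ I)) ∎
    where
    j = J zero
    F : ℕ → Carrier
    F i = W i J * Φ (i ∷ J)
    W′ : ℕ → (Fin k → ℕ) → Carrier
    W′ i K = W i (j ∷ K)
    W′-resp : ∀ i → RespectsPointwise (W′ i)
    W′-resp i I≗K = W-resp i (λ { zero → ≡.refl ; (suc a) → I≗K a })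
    Fj≈0 : F j ≈ 0#
    Fj≈0 = trans (*-congˡ (repeated-0 Φ-alt zero (j ∷ J) ≡.refl)) (zeroʳ _)
    later-term : ∀ i → suc j ℕ.≤ i → i ℕ.< N → F i ≈ W′ i (J ∘ suc) * - Φ (j ∷ i ∷ J ∘ suc)
    later-term i _ _ = *-cong (W-resp i (λ { zero → ≡.refl ; (suc a) → ≡.refl }))
      (trans (resp-≗ Φ-alt (λ { zero → ≡.refl ; (suc zero) → ≡.refl ; (suc (suc a)) → ≡.refl }))
             (swap-‿ Φ-alt zero (j ∷ i ∷ J ∘ suc)))
    reindex : ∀ I p → sign (toℕ p) (W′ (I p) (I ∘ punchIn p) * - Φ (j ∷ I)) ≈
                      sign (suc (toℕ p)) (W (I p) ((j ∷ I) ∘ punchIn (suc p)) * Φ (j ∷ I))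
    reindex I p = trans
      (sign-cong (toℕ p) (trans (sym (-‿distribʳ-* _ _))
        (-‿cong (*-congʳ (W-resp (I p) (λ { zero → ≡.refl ; (suc a) → ≡.refl }))))))
      (sign-‿ (toℕ p) _)

  selectColumns : ∀ {m} → (Fin m → ℕ → Carrier) → (Fin m → ℕ) → Fin m → Fin m → Carrier
  selectColumns A I a b = A a (I b)

  selectRows : ∀ {m} → (ℕ → Fin m → Carrier) → (Fin m → ℕ) → Fin m → Fin m → Carrier
  selectRows B I a b = B (I a) b

  product : ∀ {m} → ℕ → (Fin m → ℕ → Carrier) → (ℕ → Fin m → Carrier) → Fin m → Fin m → Carrier
  product N A B a b = Σ< N (λ j → A a j * B j b)

  det-selectColumns-resp : ∀ m (A : Fin m → ℕ → Carrier) → RespectsPointwise (λ I → det′ m (selectColumns A I))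
  det-selectColumns-resp m A I≗J = det-cong m (λ a b → reflexive (≡.cong (A a) (I≗J b)))

  det-selectRows-alternating : ∀ m (B : ℕ → Fin (suc m) → Carrier) →
                               Alternating (λ I → det′ (suc m) (selectRows B I))
  det-selectRows-alternating m B = record
    { resp-≗     = λ I≗J → det-cong (suc m) (λ a b → reflexive (≡.cong (λ t → B t b) (I≗J a)))
    ; swap-‿     = λ q I → det-swapAdjacent m q (selectRows B I)
    ; repeated-0 = λ q I e → det-repeatedAdjacent m q (selectRows B I) (≡.cong B e)
    }

  CauchyBinet : ℕ → Set (c ⊔ ℓ₁)
  CauchyBinet m = ∀ (A : Fin m → ℕ → Carrier) (B : ℕ → Fin m → Carrier) N →
    det′ m (product N A B) ≈ Σ-increasing m 0 N (λ I → det′ m (selectColumns A I) * det′ m (selectRows B I))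

  det-product-first-row : ∀ m → CauchyBinet m → ∀ (A : Fin (suc m) → ℕ → Carrier) B N →
    det′ (suc m) (product N A B) ≈ Σ< N (λ i → Σ-increasing m 0 N (λ J →
      (det′ m (selectColumns (A ∘ suc) J) * A zero i) * det′ (suc m) (selectRows B (i ∷ J))))
  det-product-first-row m cauchy-binetₘ A B N = begin
    ΣFin (suc m) (λ b → sign (toℕ b) (product N A B zero b * det′ m (minor (product N A B) b)))
      ≈⟨ linear-cong Σₘ₊₁ (λ b → sign-cong (toℕ b)
           (*-congˡ {x = product N A B zero b} (cauchy-binetₘ (A ∘ suc) (B′ b) N))) ⟩
    ΣFin (suc m) (λ b → sign (toℕ b) (Σ< N (λ i → A zero i * B i b) * Σ-increasing m 0 N (λ J → dA J * dB b J)))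
      ≈⟨ linear-cong Σₘ₊₁ expand ⟩
    ΣFin (suc m) (λ b → Σ< N (λ i → Σ-increasing m 0 N (term b i)))
      ≈⟨ linear-Σ< Σₘ₊₁ N (λ b i → Σ-increasing m 0 N (term b i)) ⟩
    Σ< N (λ i → ΣFin (suc m) (λ b → Σ-increasing m 0 N (term b i)))
      ≈⟨ linear-cong (Σ<-linear N) (λ i →
           sym (linear-ΣFin (Σ-increasing-linear m 0 N) (suc m) (λ J b → term b i J))) ⟩
    Σ< N (λ i → Σ-increasing m 0 N (λ J → ΣFin (suc m) (λ b → term b i J)))
      ≈⟨ linear-cong (Σ<-linear N) (λ i → linear-cong (Σ-increasing-linear m 0 N) (collect i)) ⟩
    Σ< N (λ i → Σ-increasing m 0 N (λ J → (dA J * A zero i) * det′ (suc m) (selectRows B (i ∷ J)))) ∎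
    where
    Σₘ₊₁ = ΣFin-linear (suc m)
    B′ : Fin (suc m) → ℕ → Fin m → Carrier
    B′ b j s = B j (punchIn b s)
    dA : (Fin m → ℕ) → Carrier
    dA J = det′ m (selectColumns (A ∘ suc) J)
    dB : Fin (suc m) → (Fin m → ℕ) → Carrier
    dB b J = det′ m (selectRows (B′ b) J)
    term : Fin (suc m) → ℕ → (Fin m → ℕ) → Carrier
    term b i J = sign (toℕ b) ((A zero i * B i b) * (dA J * dB b J))
    expand : ∀ b → sign (toℕ b) (Σ< N (λ i → A zero i * B i b) * Σ-increasing m 0 N (λ J → dA J * dB b J)) ≈
                   Σ< N (λ i → Σ-increasing m 0 N (term b i))
    expand b = begin
      sign (toℕ b) (Σ< N (λ i → A zero i * B i b) * Σ-increasing m 0 N (λ J → dA J * dB b J))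
        ≈⟨ sign-cong (toℕ b) (sym (linear-*ʳ (Σ<-linear N) _ (λ i → A zero i * B i b))) ⟩
      sign (toℕ b) (Σ< N (λ i → (A zero i * B i b) * Σ-increasing m 0 N (λ J → dA J * dB b J)))
        ≈⟨ sign-cong (toℕ b) (linear-cong (Σ<-linear N) (λ i →
             sym (linear-*ˡ (Σ-increasing-linear m 0 N) (A zero i * B i b) (λ J → dA J * dB b J)))) ⟩
      sign (toℕ b) (Σ< N (λ i → Σ-increasing m 0 N (λ J → (A zero i * B i b) * (dA J * dB b J))))
        ≈⟨ linear-sign (toℕ b) (Σ<-linear N)
             (λ i → Σ-increasing m 0 N (λ J → (A zero i * B i b) * (dA J * dB b J))) ⟩
      Σ< N (λ i → sign (toℕ b) (Σ-increasing m 0 N (λ J → (A zero i * B i b) * (dA J * dB b J))))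
        ≈⟨ linear-cong (Σ<-linear N) (λ i →
             linear-sign (toℕ b) (Σ-increasing-linear m 0 N) (λ J → (A zero i * B i b) * (dA J * dB b J))) ⟩
      Σ< N (λ i → Σ-increasing m 0 N (term b i)) ∎
    collect : ∀ i J → ΣFin (suc m) (λ b → term b i J) ≈ (dA J * A zero i) * det′ (suc m) (selectRows B (i ∷ J))
    collect i J = trans
      (linear-cong Σₘ₊₁ (λ b → trans
        (sign-cong (toℕ b) (trans (*-interchange _ _ _ _) (*-congʳ (*-comm (A zero i) (dA J)))))
        (sign-*ˡ (toℕ b) (dA J * A zero i) (B i b * dB b J))))
      (linear-*ˡ Σₘ₊₁ (dA J * A zero i) (λ b → sign (toℕ b) (B i b * dB b J)))

  -- Read right to left: expand each det (selectColumns A I) along its first row, then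
  -- un-sort the column chosen there by alternating-insert.
  Σ-increasing-laplace : ∀ m N (A : Fin (suc m) → ℕ → Carrier) {Φ : (Fin (suc m) → ℕ) → Carrier} →
    Alternating Φ →
    Σ< N (λ i → Σ-increasing m 0 N (λ J → (det′ m (selectColumns (A ∘ suc) J) * A zero i) * Φ (i ∷ J))) ≈
    Σ-increasing (suc m) 0 N (λ I → det′ (suc m) (selectColumns A I) * Φ I)
  Σ-increasing-laplace m N A {Φ} Φ-alt = begin
    Σ< N (λ i → Σ-increasing m 0 N (λ J → W i J * Φ (i ∷ J)))
      ≈⟨ sym (linear-Σ< (Σ-increasing-linear m 0 N) N (λ J i → W i J * Φ (i ∷ J))) ⟩
    Σ-increasing m 0 N (λ J → Σ< N (λ i → W i J * Φ (i ∷ J)))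
      ≈⟨ Σ-increasing-cong m 0 N (λ J inc →
           trans (sym (Σ-between-0 N (λ i → W i J * Φ (i ∷ J)))) (alternating-insert m 0 N Φ-alt W W-resp J inc)) ⟩
    Σ-increasing m 0 N (λ J → Σ-insertions m 0 N J G)
      ≈⟨ Σ-increasing-insertions m 0 N G ⟩
    Σ-increasing (suc m) 0 N (λ I → ΣFin (suc m) (G I))
      ≈⟨ linear-cong (Σ-increasing-linear (suc m) 0 N) (λ I →
           trans (linear-cong Σₘ₊₁ (G-laplace I)) (linear-*ʳ Σₘ₊₁ (Φ I) (laplaceTerm (selectColumns A I)))) ⟩
    Σ-increasing (suc m) 0 N (λ I → det′ (suc m) (selectColumns A I) * Φ I) ∎
    where
    Σₘ₊₁ = ΣFin-linear (suc m)
    W : ℕ → (Fin m → ℕ) → Carrier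
    W i J = det′ m (selectColumns (A ∘ suc) J) * A zero i
    W-resp : ∀ i → RespectsPointwise (W i)
    W-resp i I≗J = *-congʳ (det-selectColumns-resp m (A ∘ suc) I≗J)
    G : (Fin (suc m) → ℕ) → Fin (suc m) → Carrier
    G I p = sign (toℕ p) (W (I p) (I ∘ punchIn p) * Φ I)
    G-laplace : ∀ I p → G I p ≈ laplaceTerm (selectColumns A I) p * Φ I
    G-laplace I p = trans (sign-*ʳ (toℕ p) _ (Φ I)) (*-congʳ (sign-cong (toℕ p) (*-comm _ _)))

  cauchy-binet : ∀ m → CauchyBinet m
  cauchy-binet zero    A B N = sym (*-identityˡ 1#)
  cauchy-binet (suc m) A B N = trans (det-product-first-row m (cauchy-binet m) A B N)
                                     (Σ-increasing-laplace m N A (det-selectRows-alternating m B))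

  det-product-nonneg : ∀ m N (A : Fin m → ℕ → Carrier) (B : ℕ → Fin m → Carrier) →
    (∀ I → StrictlyIncreasing OR I → 0# ≤ det′ m (selectColumns A I)) →
    (∀ I → StrictlyIncreasing OR I → 0# ≤ det′ m (selectRows B I)) →
    0# ≤ det′ m (product N A B)
  det-product-nonneg m N A B A-minors B-minors = ≤.trans
    (Σ-increasing-nonneg m 0 N (λ I inc → let I↑ = IncreasingIn⇒StrictlyIncreasing m 0 N I inc in
      *-nonneg (A-minors I I↑) (B-minors I I↑)))
    (≤.reflexive (sym (cauchy-binet m A B N)))

  -- Riordan arrays

  infixl 7 _⊛_
  _⊛_ : Series OR → Series OR → Series OR
  _⊛_ = _·_ OR

  ⊛-identityʳ : ∀ f n → (f ⊛ one OR) n ≈ f n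
  ⊛-identityʳ f n = begin
    Σ< n (λ i → f i * one OR (n ∸ i)) + f n * one OR (n ∸ n)
      ≈⟨ +-cong (trans (Σ<-cong n (λ i i<n → trans (*-congˡ (one-∸ n i i<n)) (zeroʳ _))) (linear-0 (Σ<-linear n)))
                (*-congˡ (reflexive (≡.cong (one OR) (ℕₚ.n∸n≡0 n)))) ⟩
    0# + f n * 1# ≈⟨ trans (+-identityˡ _) (*-identityʳ _) ⟩
    f n ∎
    where
    one-∸ : ∀ n i → i ℕ.< n → one OR (n ∸ i) ≈ 0#
    one-∸ (suc n) zero    _         = refl
    one-∸ (suc n) (suc i) (s≤s i<n) = one-∸ n i i<n

  ⊛-assoc : ∀ f g k n → (f ⊛ (g ⊛ k)) n ≈ ((f ⊛ g) ⊛ k) n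
  ⊛-assoc f g k n = begin
    Σ< (suc n) (λ i → f i * Σ< (suc (n ∸ i)) (λ l → g l * k (n ∸ i ∸ l)))
      ≈⟨ sym (Σ-between-0 (suc n) _) ⟩
    Σ-between 0 (suc n) (λ i → f i * Σ< (suc (n ∸ i)) (λ l → g l * k (n ∸ i ∸ l)))
      ≈⟨ Σ-between-cong 0 (suc n) (λ i _ i<1+n → reindex i (ℕₚ.≤-pred i<1+n)) ⟩
    Σ-between 0 (suc n) (λ i → Σ-between i (suc n) (λ j → (f i * g (j ∸ i)) * k (n ∸ j)))
      ≈⟨ sym (Σ-between-triangle-≤ 0 (suc n) (λ i j → (f i * g (j ∸ i)) * k (n ∸ j))) ⟩
    Σ-between 0 (suc n) (λ j → Σ-between 0 (suc j) (λ i → (f i * g (j ∸ i)) * k (n ∸ j)))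
      ≈⟨ linear-cong (Σ-between-linear 0 (suc n)) (λ j →
           trans (Σ-between-0 (suc j) _) (linear-*ʳ (Σ<-linear (suc j)) (k (n ∸ j)) (λ i → f i * g (j ∸ i)))) ⟩
    Σ-between 0 (suc n) (λ j → (f ⊛ g) j * k (n ∸ j))
      ≈⟨ Σ-between-0 (suc n) _ ⟩
    ((f ⊛ g) ⊛ k) n ∎
    where
    ∸-∸ : ∀ i j → i ℕ.≤ j → n ∸ i ∸ (j ∸ i) ≡ n ∸ j
    ∸-∸ i j i≤j = ≡.trans (ℕₚ.∸-+-assoc n i (j ∸ i)) (≡.cong (n ∸_) (ℕₚ.m+[n∸m]≡n i≤j))
    reindex : ∀ i → i ℕ.≤ n → f i * Σ< (suc (n ∸ i)) (λ l → g l * k (n ∸ i ∸ l)) ≈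
                              Σ-between i (suc n) (λ j → (f i * g (j ∸ i)) * k (n ∸ j))
    reindex i i≤n = begin
      f i * Σ< (suc (n ∸ i)) (λ l → g l * k (n ∸ i ∸ l))
        ≈⟨ *-congˡ (Σ<-shift i (suc (n ∸ i)) _) ⟩
      f i * Σ-between i (i ℕ.+ suc (n ∸ i)) (λ j → g (j ∸ i) * k (n ∸ i ∸ (j ∸ i)))
        ≈⟨ *-congˡ (reflexive (≡.cong (λ t → Σ-between i t (λ j → g (j ∸ i) * k (n ∸ i ∸ (j ∸ i))))
             (≡.trans (ℕₚ.+-suc i (n ∸ i)) (≡.cong suc (ℕₚ.m+[n∸m]≡n i≤n))))) ⟩
      f i * Σ-between i (suc n) (λ j → g (j ∸ i) * k (n ∸ i ∸ (j ∸ i)))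
        ≈⟨ sym (linear-*ˡ (Σ-between-linear i (suc n)) (f i) _) ⟩
      Σ-between i (suc n) (λ j → f i * (g (j ∸ i) * k (n ∸ i ∸ (j ∸ i))))
        ≈⟨ Σ-between-cong i (suc n) (λ j i≤j _ →
             trans (sym (*-assoc _ _ _)) (*-congˡ (reflexive (≡.cong k (∸-∸ i j i≤j))))) ⟩
      Σ-between i (suc n) (λ j → (f i * g (j ∸ i)) * k (n ∸ j)) ∎

  bordered : Matrix OR → Matrix OR
  bordered M zero    k       = one OR k
  bordered M (suc j) zero    = 0#
  bordered M (suc j) (suc k) = M j k

  module _ (d h : Series OR) where

    R H : Matrix OR
    R = riordan OR d h
    H = hessenberg OR d h

    hessenberg-suc : ∀ n j → j ℕ.≤ n → H n (suc j) ≈ h (n ∸ j)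
    hessenberg-suc n j j≤n with j ℕ.≤? n
    ... | yes _   = refl
    ... | no j≰n = ⊥-elim (j≰n j≤n)

    hessenberg-above : ∀ n j → n ℕ.< j → H n (suc j) ≈ 0#
    hessenberg-above n j n<j with j ℕ.≤? n
    ... | yes j≤n = ⊥-elim (ℕₚ.<⇒≱ n<j j≤n)
    ... | no _    = refl

    riordan-factorisation : ∀ n k N → suc n ℕ.< N → R n k ≈ Σ< N (λ j → H n j * bordered R j k)
    riordan-factorisation n zero (suc N) _ = begin
      (d ⊛ one OR) n
        ≈⟨ ⊛-identityʳ d n ⟩
      d n
        ≈⟨ sym (trans (+-identityʳ _) (*-identityʳ (d n))) ⟩
      d n * 1# + 0#
        ≈⟨ +-congˡ (sym (linear-zero (Σ<-linear N) _ (λ j → zeroʳ (H n (suc j))))) ⟩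
      d n * 1# + Σ< N (λ j → H n (suc j) * 0#)
        ≈⟨ sym (Σ<-first N _) ⟩
      Σ< (suc N) (λ j → H n j * bordered R j 0) ∎
    riordan-factorisation n (suc k) (suc N) 1+n<1+N = begin
      R n (suc k)
        ≈⟨ ⊛-assoc d (pow OR h k) h n ⟩
      Σ< (suc n) (λ j → R j k * h (n ∸ j))
        ≈⟨ Σ<-cong (suc n) (λ j j<1+n →
             trans (*-comm _ _) (*-congʳ (sym (hessenberg-suc n j (ℕₚ.≤-pred j<1+n))))) ⟩
      Σ< (suc n) G
        ≈⟨ sym (Σ<-vanishing-tail (suc n) N G (ℕₚ.≤-pred 1+n<1+N)
             (λ j n<j → trans (*-congʳ (hessenberg-above n j n<j)) (zeroˡ _))) ⟩
      Σ< N G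
        ≈⟨ sym (trans (+-congʳ (zeroʳ (d n))) (+-identityˡ _)) ⟩
      d n * 0# + Σ< N G
        ≈⟨ sym (Σ<-first N _) ⟩
      Σ< (suc N) (λ j → H n j * bordered R j (suc k)) ∎
      where
      G : ℕ → Carrier
      G j = H n (suc j) * R j k

  TotallyPositiveBelow : Matrix OR → ℕ → Set ℓ₂
  TotallyPositiveBelow M K = ∀ m (rows cols : Fin m → ℕ) →
    StrictlyIncreasing OR rows → StrictlyIncreasing OR cols → (∀ b → cols b ℕ.< K) →
    0# ≤ det′ m (λ a b → M (rows a) (cols b))

  module _ {m} (σ : Fin (suc m) → ℕ) (σ↑ : StrictlyIncreasing OR σ) where

    head-≤ : ∀ a → σ zero ℕ.≤ σ a
    head-≤ zero    = ℕₚ.≤-refl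
    head-≤ (suc a) = ℕₚ.<⇒≤ (σ↑ zero (suc a) (s≤s z≤n))

    tail-positive : ∀ a → 0 ℕ.< σ (suc a)
    tail-positive a = ℕₚ.≤-trans (s≤s z≤n) (σ↑ zero (suc a) (s≤s z≤n))

    tail-StrictlyIncreasing : StrictlyIncreasing OR (σ ∘ suc)
    tail-StrictlyIncreasing a b a<b = σ↑ (suc a) (suc b) (s≤s a<b)

  pred-StrictlyIncreasing : ∀ {m} (σ : Fin m → ℕ) → (∀ a → 0 ℕ.< σ a) → StrictlyIncreasing OR σ →
                            StrictlyIncreasing OR (ℕ.pred ∘ σ)
  pred-StrictlyIncreasing σ σ>0 σ↑ a b a<b = pred-< (σ>0 a) (σ↑ a b a<b)
    where
    pred-< : ∀ {x y} → 0 ℕ.< x → x ℕ.< y → ℕ.pred x ℕ.< ℕ.pred y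
    pred-< {suc x} {suc y} _ x<y = ℕₚ.≤-pred x<y

  module _ (M : Matrix OR) where

    bordered-top : ∀ {k} → 0 ℕ.< k → bordered M 0 k ≈ 0#
    bordered-top {suc k} _ = refl

    bordered-left : ∀ {j} → 0 ℕ.< j → bordered M j 0 ≈ 0#
    bordered-left {suc j} _ = refl

    bordered-inner : ∀ {j k} → 0 ℕ.< j → 0 ℕ.< k → bordered M j k ≈ M (ℕ.pred j) (ℕ.pred k)
    bordered-inner {suc j} {suc k} _ _ = refl

  -- A minor of 1 ⊕ M vanishes when exactly one of its first row and column is the border,
  -- and otherwise is a minor of M (after expanding along the corner 1 if both are).
  bordered-TotallyPositiveBelow : ∀ M K → TotallyPositiveBelow M K → TotallyPositiveBelow (bordered M) (suc K)
  bordered-TotallyPositiveBelow M K M-tp zero    I cs _  _   _       = 0≤1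
  bordered-TotallyPositiveBelow M K M-tp (suc m) I cs I↑ cs↑ cs<1+K =
    by-corner (zero-or-positive (I zero)) (zero-or-positive (cs zero))
    where
    B : Fin (suc m) → Fin (suc m) → Carrier
    B a b = bordered M (I a) (cs b)
    by-corner : I zero ≡ 0 ⊎ 0 ℕ.< I zero → cs zero ≡ 0 ⊎ 0 ℕ.< cs zero → 0# ≤ det′ (suc m) B
    by-corner (inj₁ I₀≡0) (inj₁ cs₀≡0) = ≤.trans
      (M-tp m (ℕ.pred ∘ I ∘ suc) (ℕ.pred ∘ cs ∘ suc)
        (pred-StrictlyIncreasing (I ∘ suc) (tail-positive I I↑) (tail-StrictlyIncreasing I I↑))
        (pred-StrictlyIncreasing (cs ∘ suc) (tail-positive cs cs↑) (tail-StrictlyIncreasing cs cs↑))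
        (λ b → pred-<-suc (tail-positive cs cs↑ b) (cs<1+K (suc b))))
      (≤.reflexive (sym (trans
        (det-unit-first-row m B (reflexive (≡.cong₂ (bordered M) I₀≡0 cs₀≡0)) (λ b →
          trans (reflexive (≡.cong (λ t → bordered M t (cs (suc b))) I₀≡0))
                (bordered-top M (tail-positive cs cs↑ b))))
        (det-cong m (λ r s → bordered-inner M (tail-positive I I↑ r) (tail-positive cs cs↑ s))))))
    by-corner (inj₁ I₀≡0) (inj₂ cs₀>0) = ≤.reflexive (sym (det-zero-first-row m B (λ b →
      trans (reflexive (≡.cong (λ t → bordered M t (cs b)) I₀≡0))
            (bordered-top M (ℕₚ.≤-trans cs₀>0 (head-≤ cs cs↑ b))))))
    by-corner (inj₂ I₀>0) (inj₁ cs₀≡0) = ≤.reflexive (sym (det-zero-first-column m B (λ a →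
      trans (reflexive (≡.cong (bordered M (I a)) cs₀≡0))
            (bordered-left M (ℕₚ.≤-trans I₀>0 (head-≤ I I↑ a))))))
    by-corner (inj₂ I₀>0) (inj₂ cs₀>0) = ≤.trans
      (M-tp (suc m) (ℕ.pred ∘ I) (ℕ.pred ∘ cs)
        (pred-StrictlyIncreasing I I>0 I↑) (pred-StrictlyIncreasing cs cs>0 cs↑)
        (λ b → pred-<-suc (cs>0 b) (cs<1+K b)))
      (≤.reflexive (sym (det-cong (suc m) (λ a b → bordered-inner M (I>0 a) (cs>0 b)))))
      where
      I>0 : ∀ a → 0 ℕ.< I a
      I>0 a = ℕₚ.≤-trans I₀>0 (head-≤ I I↑ a)
      cs>0 : ∀ b → 0 ℕ.< cs b
      cs>0 b = ℕₚ.≤-trans cs₀>0 (head-≤ cs cs↑ b)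

  riordan-TotallyPositiveBelow : ∀ d h → TotallyPositive OR (hessenberg OR d h) →
                                 ∀ K → TotallyPositiveBelow (riordan OR d h) K
  riordan-TotallyPositiveBelow d h H-tp zero    zero    rows cols _ _ _ = 0≤1
  riordan-TotallyPositiveBelow d h H-tp zero    (suc m) rows cols _ _ cols<0 = ⊥-elim (ℕₚ.n≮0 (cols<0 zero))
  riordan-TotallyPositiveBelow d h H-tp (suc K) m rows cols rows↑ cols↑ cols<1+K = ≤.trans
    (det-product-nonneg m N (λ a j → H d h (rows a) j) (λ j b → bordered (R d h) j (cols b))
      (λ I I↑ → H-tp m rows I rows↑ I↑)
      (λ I I↑ → bordered-TotallyPositiveBelow (R d h) K (riordan-TotallyPositiveBelow d h H-tp K)
                                              m I cols I↑ cols↑ cols<1+K))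
    (≤.reflexive (det-cong m (λ a b →
      sym (riordan-factorisation d h (rows a) (cols b) N (s≤s (s≤s (≤-upperBound rows a)))))))
    where
    N = suc (suc (upperBound rows))

theorem3 : ∀ {c ℓ₁ ℓ₂ : Level} (R : OrderedCommutativeRing c ℓ₁ ℓ₂)
             (d h : Series R) →
             TotallyPositive R (hessenberg R d h) →
             TotallyPositive R (riordan R d h)
theorem3 R d h H-tp m rows cols rows↑ cols↑ =
  riordan-TotallyPositiveBelow R d h H-tp (suc (upperBound cols)) m rows cols rows↑ cols↑
    (λ b → s≤s (≤-upperBound cols b))
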